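{- Let $g\colon\{0,1\}^n\to\{0,1\}$ be any function. Then $f(x,y)=g(x\vee y)$ (for $x,y\in\{0,1\}^n$) admits a 2-party BSM protocol of size $O(2^{0.729n})$.
   Context: $x\vee y$ denotes bitwise OR. A 2-party BSM protocol of size $s$ for $f\colon\{0,1\}^n\times\{0,1\}^n\to\{0,1\}$ consists of arbitrary functions $A$ (Alice) and $B$ (Bob) mapping $\{0,1\}^n$ to bit strings and a Boolean circuit $C$ (Carol) of size $s$ such that $f(x,y)=C(A(x),B(y))$ for all $x,y$. -}

module Defs where

open import Data.Bool using (Bool; _∨_)
open import Data.Nat using (ℕ; zero; suc; _+_; _*_; _^_; _≤_)
open import Data.Fin using (Fin)
open import Data.Vec using (Vec; []; _∷_; lookup; _++_; zipWith)
open import Data.Product using (Σ; ∃; _×_)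
open import Relation.Binary.PropositionalEquality using (_≡_)

BitString : ℕ → Set
BitString n = Vec Bool n

_⋁_ : ∀ {n} → BitString n → BitString n → BitString n
_⋁_ = zipWith _∨_

record Gate (w : ℕ) : Set where
  field
    op  : Bool → Bool → Bool
    in₁ : Fin w
    in₂ : Fin w

-- A sequence of s gates over m inputs. Wires are numbered with the most
-- recently added gate first and the m inputs last, so after s gates there
-- are s + m wires.
data Gates (m : ℕ) : ℕ → Set where
  []  : Gates m zero
  _▷_ : ∀ {s} → Gates m s → Gate (s + m) → Gates m (suc s)

evalWires : ∀ {m s} → Gates m s → BitString m → BitString (s + m)
evalWires [] x = x
evalWires (gs ▷ g) x =
  let w = evalWires gs x
  in Gate.op g (lookup w (Gate.in₁ g)) (lookup w (Gate.in₂ g)) ∷ w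

record Circuit (m s : ℕ) : Set where
  field
    gates  : Gates m s
    output : Fin (s + m)

evalCircuit : ∀ {m s} → Circuit m s → BitString m → Bool
evalCircuit C x = lookup (evalWires (Circuit.gates C) x) (Circuit.output C)

record BSM (n : ℕ) (f : BitString n → BitString n → Bool) (s : ℕ) : Set where
  field
    lenA lenB : ℕ
    alice   : BitString n → BitString lenA
    bob     : BitString n → BitString lenB
    carol   : Circuit (lenA + lenB) s
    correct : ∀ x y → evalCircuit carol (alice x ++ bob y) ≡ f x y

-- Each party sends its input z together with a table of all pairs (w, g w) where w is
-- obtained from z by switching on k of its zeros and leaving the other l off, for every
-- (k, l) with C(k + l, k) ≤ 2^(⌊0.701 n⌋ + 1). For the target x ∨ y, let k and k′ count
-- the ones of y outside x and of x outside y, and l the common zeros. Since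
-- k + k′ + l ≤ n, one of 2k + l and 2k′ + l is at most n, and
-- C(k + l, k) ≤ 13^(k+l) / (5^k 8^l) ≤ 2^(0.701 (2k + l)), so x ∨ y lies in one of the two
-- tables. Carol outputs the OR, over all entries of both tables equal to x ∨ y, of the
-- stored value. The tables have O(n² 2^(0.701 n)) entries and each test costs O(n) gates,
-- so the circuit has O(n³ 2^(0.701 n)) = O(2^(0.729 n)) gates.

module Submission where

open import Defs
open import Data.Bool using (Bool)
open import Data.Nat using (ℕ; _*_; _^_; _≤_)
open import Data.Product using (Σ; ∃; _×_)

open import Data.Bool using (true; false; not; _∧_; _∨_; _xor_) renaming (_≤_ to _≤ᴮ_)
open import Data.Bool.Properties
  using (∧-conicalˡ; ∧-conicalʳ; ∨-comm; xor-same; ≤-minimum; ≤-maximum)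
  renaming (≤-refl to ≤ᴮ-refl; ≤-reflexive to ≤ᴮ-reflexive; ≤-trans to ≤ᴮ-trans; ≤-antisym to ≤ᴮ-antisym)
open import Data.Nat using (zero; suc; _+_; _<_; _≤?_; z≤n; s≤s; NonZero; _/_; _%_)
open import Data.Nat.Properties
open import Data.Nat.DivMod using (m≡m%n+[m/n]*n; m%n<n; m/n*n≤m)
open import Data.Nat.Tactic.RingSolver using (solve-∀)
open import Algebra.Properties.CommutativeSemigroup *-commutativeSemigroup using ()
  renaming (interchange to *-interchange)
open import Data.Fin using (Fin; zero; suc; _↑ˡ_; _↑ʳ_; combine)
open import Data.Vec using (Vec; []; _∷_; lookup; map; _++_; concat; tabulate)
open import Data.Vec.Properties
  using (lookup-++ˡ; lookup-++ʳ; lookup-map; lookup-concat; lookup-zipWith; zipWith-comm;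
         tabulate∘lookup; tabulate-cong)
open import Data.Vec.Functional using (foldr)
open import Data.List as List using (List; length; concatMap; upTo)
open import Data.List.Properties using (length-map; length-++; length-upTo)
open import Data.List.Membership.Propositional using (_∈_)
open import Data.List.Membership.Propositional.Properties
  using (∈-map⁺; ∈-++⁺ˡ; ∈-++⁺ʳ; ∈-concatMap⁺; ∈-upTo⁺)
open import Data.List.Relation.Unary.Any as Any using (here; there)
open import Data.Product using (_,_; proj₁; proj₂)
open import Data.Sum using (_⊎_; inj₁; inj₂)
open import Function using (_∘_)
open import Relation.Nullary using (yes; no; contradiction)
open import Relation.Binary.PropositionalEquality

private variable
  A B : Set
  a b c : Bool
  d k l m n r s t u e f : ℕ

∨-lub : a ≤ᴮ c → b ≤ᴮ c → a ∨ b ≤ᴮ c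
∨-lub {false} _   b≤c = b≤c
∨-lub {true}  a≤c _   = a≤c

≤-∨ˡ : a ≤ᴮ a ∨ b
≤-∨ˡ {false} = ≤-minimum _
≤-∨ˡ {true}  = ≤ᴮ-refl

≤-∨ʳ : b ≤ᴮ a ∨ b
≤-∨ʳ {a = false} = ≤ᴮ-refl
≤-∨ʳ {a = true}  = ≤-maximum _

foldr-∨-lub : (bs : Fin k → Bool) → a ≤ᴮ c → (∀ j → bs j ≤ᴮ c) → foldr _∨_ a bs ≤ᴮ c
foldr-∨-lub {k = zero}  bs a≤c _    = a≤c
foldr-∨-lub {k = suc k} bs a≤c bs≤c = ∨-lub (bs≤c zero) (foldr-∨-lub (bs ∘ suc) a≤c (bs≤c ∘ suc))

≤-foldr-∨-init : (bs : Fin k → Bool) → c ≤ᴮ a → c ≤ᴮ foldr _∨_ a bs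
≤-foldr-∨-init {k = zero}  bs c≤a = c≤a
≤-foldr-∨-init {k = suc k} bs c≤a = ≤ᴮ-trans (≤-foldr-∨-init (bs ∘ suc) c≤a) (≤-∨ʳ {a = bs zero})

≤-foldr-∨ : (bs : Fin k → Bool) (j : Fin k) → c ≤ᴮ bs j → c ≤ᴮ foldr _∨_ a bs
≤-foldr-∨ bs zero    c≤b = ≤ᴮ-trans c≤b ≤-∨ˡ
≤-foldr-∨ bs (suc j) c≤b = ≤ᴮ-trans (≤-foldr-∨ (bs ∘ suc) j c≤b) (≤-∨ʳ {a = bs zero})

any⁺ : (Fin (suc k) → Bool) → Bool
any⁺ bs = foldr _∨_ (bs zero) (bs ∘ suc)

any⁺-lub : (bs : Fin (suc k) → Bool) → (∀ j → bs j ≤ᴮ c) → any⁺ bs ≤ᴮ c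
any⁺-lub bs bs≤c = foldr-∨-lub (bs ∘ suc) (bs≤c zero) (bs≤c ∘ suc)

≤-any⁺ : (bs : Fin (suc k) → Bool) (j : Fin (suc k)) → c ≤ᴮ bs j → c ≤ᴮ any⁺ bs
≤-any⁺ bs zero    = ≤-foldr-∨-init (bs ∘ suc)
≤-any⁺ bs (suc j) = ≤-foldr-∨ (bs ∘ suc) j

foldr-∧-true⁻ : (bs : Fin k → Bool) → foldr _∧_ a bs ≡ true → a ≡ true × (∀ j → bs j ≡ true)
foldr-∧-true⁻ {k = zero}  bs a≡t = a≡t , λ ()
foldr-∧-true⁻ {k = suc k} bs eq with foldr-∧-true⁻ (bs ∘ suc) (∧-conicalʳ (bs zero) _ eq)
... | a≡t , rest≡t = a≡t , λ { zero → ∧-conicalˡ _ _ eq ; (suc j) → rest≡t j }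

foldr-∧-true : (bs : Fin k → Bool) → (∀ j → bs j ≡ true) → foldr _∧_ a bs ≡ a
foldr-∧-true {k = zero}  bs _      = refl
foldr-∧-true {k = suc k} bs all≡t rewrite all≡t zero = foldr-∧-true (bs ∘ suc) (all≡t ∘ suc)

-- Formulas

data Formula (m : ℕ) : Set where
  input : Fin m → Formula m
  gate  : (Bool → Bool → Bool) → Formula m → Formula m → Formula m

size : Formula m → ℕ
size (input _)    = 0
size (gate _ φ ψ) = suc (size φ + size ψ)

⟦_⟧ : Formula m → (Fin m → Bool) → Bool
⟦ input i ⟧     ρ = ρ i
⟦ gate op φ ψ ⟧ ρ = op (⟦ φ ⟧ ρ) (⟦ ψ ⟧ ρ)

infix 4 _≼_

data _≼_ {m} : Gates m s → Gates m t → Set where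
  ≼-refl : {gs : Gates m s} → gs ≼ gs
  _▷_    : {gs : Gates m s} {hs : Gates m t} → gs ≼ hs → (g : Gate (t + m)) → gs ≼ hs ▷ g

≼-trans : {gs : Gates m s} {hs : Gates m t} {ks : Gates m u} → gs ≼ hs → hs ≼ ks → gs ≼ ks
≼-trans e ≼-refl   = e
≼-trans e (e′ ▷ g) = ≼-trans e e′ ▷ g

weaken : {gs : Gates m s} {hs : Gates m t} → gs ≼ hs → Fin (s + m) → Fin (t + m)
weaken ≼-refl  i = i
weaken (e ▷ _) i = suc (weaken e i)

lookup-weaken : {gs : Gates m s} {hs : Gates m t} (e : gs ≼ hs) → ∀ x i →
                lookup (evalWires hs x) (weaken e i) ≡ lookup (evalWires gs x) i
lookup-weaken ≼-refl  x i = refl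
lookup-weaken (e ▷ _) x i = lookup-weaken e x i

lookup-inputWire : (gs : Gates m s) → ∀ x (j : Fin m) → lookup (evalWires gs x) (s ↑ʳ j) ≡ lookup x j
lookup-inputWire []       x j = refl
lookup-inputWire (gs ▷ _) x j = lookup-inputWire gs x j

record Compiled (gs : Gates m s) (φ : Formula m) : Set where
  field
    {count} : ℕ
    gates   : Gates m count
    extends : gs ≼ gates
    output  : Fin (count + m)
    counted : count ≡ s + size φ
    correct : ∀ x → lookup (evalWires gates x) output ≡ ⟦ φ ⟧ (lookup x)

compile : (φ : Formula m) (gs : Gates m s) → Compiled gs φ
compile {s = s} (input j) gs = record
  { gates   = gs
  ; extends = ≼-refl
  ; output  = s ↑ʳ j
  ; counted = sym (+-identityʳ s)
  ; correct = λ x → lookup-inputWire gs x j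
  }
compile {s = s} (gate op φ ψ) gs = record
  { gates   = Cψ.gates ▷ new
  ; extends = ≼-trans Cφ.extends Cψ.extends ▷ new
  ; output  = zero
  ; counted = counted
  ; correct = λ x → cong₂ op
      (trans (lookup-weaken Cψ.extends x Cφ.output) (Cφ.correct x)) (Cψ.correct x)
  }
  where
  module Cφ = Compiled (compile φ gs)
  module Cψ = Compiled (compile ψ Cφ.gates)
  new = record { op = op ; in₁ = weaken Cψ.extends Cφ.output ; in₂ = Cψ.output }
  counted : suc Cψ.count ≡ s + size (gate op φ ψ)
  counted = begin
    suc Cψ.count                  ≡⟨ cong suc Cψ.counted ⟩
    suc (Cφ.count + size ψ)       ≡⟨ cong (λ c → suc (c + size ψ)) Cφ.counted ⟩
    suc (s + size φ + size ψ)     ≡⟨ cong suc (+-assoc s (size φ) (size ψ)) ⟩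
    suc (s + (size φ + size ψ))   ≡⟨ +-suc s _ ⟨
    s + suc (size φ + size ψ)     ∎
    where open ≡-Reasoning

formula⇒circuit : (φ : Formula m) →
                  Σ (Circuit m (size φ)) λ C → ∀ x → evalCircuit C x ≡ ⟦ φ ⟧ (lookup x)
formula⇒circuit φ with compile φ []
... | record { gates = gs ; output = o ; counted = refl ; correct = ok } =
  record { gates = gs ; output = o } , ok

foldF : (Bool → Bool → Bool) → Formula m → ∀ {k} → (Fin k → Formula m) → Formula m
foldF op φ {zero}  ψs = φ
foldF op φ {suc k} ψs = gate op (ψs zero) (foldF op φ (ψs ∘ suc))

⟦foldF⟧ : ∀ {op} {φ : Formula m} {ψs : Fin k → Formula m} {ρ bs} → ⟦ φ ⟧ ρ ≡ a →
          (∀ j → ⟦ ψs j ⟧ ρ ≡ bs j) → ⟦ foldF op φ ψs ⟧ ρ ≡ foldr op a bs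
⟦foldF⟧ {k = zero}           φ≡a _      = φ≡a
⟦foldF⟧ {k = suc k} {op = op} φ≡a ψs≡bs = cong₂ op (ψs≡bs zero) (⟦foldF⟧ φ≡a (ψs≡bs ∘ suc))

size-foldF : ∀ {op} (φ : Formula m) (ψs : Fin k → Formula m) →
             (∀ j → size (ψs j) ≡ d) → size (foldF op φ ψs) ≡ k * suc d + size φ
size-foldF {k = zero}          φ ψs _    = refl
size-foldF {k = suc k} {d = d} φ ψs size≡ = cong suc (begin
  size (ψs zero) + size (foldF _ φ (ψs ∘ suc))  ≡⟨ cong₂ _+_ (size≡ zero) (size-foldF φ (ψs ∘ suc) (size≡ ∘ suc)) ⟩
  d + (k * suc d + size φ)                      ≡⟨ +-assoc d _ _ ⟨
  d + k * suc d + size φ                        ∎)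
  where open ≡-Reasoning

⋁F : (Fin (suc k) → Formula m) → Formula m
⋁F ψs = foldF _∨_ (ψs zero) (ψs ∘ suc)

⟦⋁F⟧ : (ψs : Fin (suc k) → Formula m) {ρ : Fin m → Bool} {bs : Fin (suc k) → Bool} →
       (∀ j → ⟦ ψs j ⟧ ρ ≡ bs j) → ⟦ ⋁F ψs ⟧ ρ ≡ any⁺ bs
⟦⋁F⟧ ψs ψs≡bs = ⟦foldF⟧ (ψs≡bs zero) (ψs≡bs ∘ suc)

size-⋁F : (ψs : Fin (suc k) → Formula m) → (∀ j → size (ψs j) ≡ d) → size (⋁F ψs) ≡ k * suc d + d
size-⋁F ψs size≡ = trans (size-foldF (ψs zero) (ψs ∘ suc) (size≡ ∘ suc)) (cong (_ +_) (size≡ zero))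

infix 5 _==_

_==_ : Bool → Bool → Bool
a == b = not (a xor b)

==⇒≡ : a == b ≡ true → a ≡ b
==⇒≡ {false} {false} _ = refl
==⇒≡ {true}  {true}  _ = refl

==-refl : ∀ a → a == a ≡ true
==-refl a = cong not (xor-same a)

-- Carol's test of a table entry z, stored with the bit v, against the target w.
accepts : Bool → BitString n → BitString n → Bool
accepts v z w = foldr _∧_ v (λ i → lookup z i == lookup w i)

accepts-sound : ∀ v (z w : BitString n) → accepts v z w ≡ true → v ≡ true × z ≡ w
accepts-sound v z w eq with foldr-∧-true⁻ (λ i → lookup z i == lookup w i) eq
... | v≡t , agree = v≡t , (begin
  z                   ≡⟨ tabulate∘lookup z ⟨
  tabulate (lookup z) ≡⟨ tabulate-cong (==⇒≡ ∘ agree) ⟩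
  tabulate (lookup w) ≡⟨ tabulate∘lookup w ⟩
  w                   ∎)
  where open ≡-Reasoning

accepts-refl : ∀ v (w : BitString n) → accepts v w w ≡ v
accepts-refl v w = foldr-∧-true _ (==-refl ∘ lookup w)

accepts-≤ : (g : BitString n → Bool) (z w : BitString n) → accepts (g z) z w ≤ᴮ g w
accepts-≤ g z w with accepts (g z) z w in eq
... | false = ≤-minimum _
... | true with accepts-sound (g z) z w eq
...   | gz≡t , refl = ≤ᴮ-reflexive (sym gz≡t)

anyAccepts : (BitString n → Bool) → Vec (BitString n) (suc k) → BitString n → Bool
anyAccepts g zs w = any⁺ λ j → accepts (g (lookup zs j)) (lookup zs j) w

anyAccepts-≤ : (g : BitString n → Bool) (zs : Vec (BitString n) (suc k)) (w : BitString n) →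
               anyAccepts g zs w ≤ᴮ g w
anyAccepts-≤ g zs w = any⁺-lub _ λ j → accepts-≤ g (lookup zs j) w

≤-anyAccepts : (g : BitString n → Bool) (zs : Vec (BitString n) (suc k)) {w : BitString n} (j : Fin (suc k)) →
               lookup zs j ≡ w → g w ≤ᴮ anyAccepts g zs w
≤-anyAccepts g zs j refl =
  ≤-any⁺ (λ i → accepts (g (lookup zs i)) (lookup zs i) (lookup zs j)) j
         (≤ᴮ-reflexive (sym (accepts-refl (g (lookup zs j)) (lookup zs j))))

-- Extensions and binomial coefficients

-- binom k l is the binomial coefficient (k + l choose k)
binom : ℕ → ℕ → ℕ
binom zero    l       = 1
binom (suc k) zero    = 1
binom (suc k) (suc l) = binom k (suc l) + binom (suc k) l

binom-zeroʳ : ∀ k → binom k 0 ≡ 1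
binom-zeroʳ zero    = refl
binom-zeroʳ (suc k) = refl

-- The z ≥ x obtained from x by switching on k of its zeros and leaving the other l off.
extensions : BitString n → ℕ → ℕ → List (BitString n)
extensions []          zero    zero    = List.[ [] ]
extensions []          _       _       = List.[]
extensions (true  ∷ x) k       l       = List.map (true ∷_) (extensions x k l)
extensions (false ∷ x) zero    zero    = List.[]
extensions (false ∷ x) zero    (suc l) = List.map (false ∷_) (extensions x zero l)
extensions (false ∷ x) (suc k) zero    = List.map (true ∷_) (extensions x k zero)
extensions (false ∷ x) (suc k) (suc l) =
  List.map (true ∷_) (extensions x k (suc l)) List.++ List.map (false ∷_) (extensions x (suc k) l)

length-extensions : (x : BitString n) → ∀ k l → length (extensions x k l) ≤ binom k l
length-extensions []          zero    zero    = ≤-refl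
length-extensions []          zero    (suc l) = z≤n
length-extensions []          (suc k) zero    = z≤n
length-extensions []          (suc k) (suc l) = z≤n
length-extensions (true  ∷ x) k       l       =
  ≤-trans (≤-reflexive (length-map _ (extensions x k l))) (length-extensions x k l)
length-extensions (false ∷ x) zero    zero    = z≤n
length-extensions (false ∷ x) zero    (suc l) =
  ≤-trans (≤-reflexive (length-map _ (extensions x zero l))) (length-extensions x zero l)
length-extensions (false ∷ x) (suc k) zero    = begin
  length (List.map (true ∷_) (extensions x k zero)) ≡⟨ length-map _ (extensions x k zero) ⟩
  length (extensions x k zero)                      ≤⟨ length-extensions x k zero ⟩
  binom k zero                                      ≡⟨ binom-zeroʳ k ⟩
  1                                                 ∎
  where open ≤-Reasoning
length-extensions (false ∷ x) (suc k) (suc l) = begin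
  length (on List.++ off)                                  ≡⟨ length-++ on ⟩
  length on + length off                                   ≡⟨ cong₂ _+_ (length-map _ (extensions x k (suc l)))
                                                                       (length-map _ (extensions x (suc k) l)) ⟩
  length (extensions x k (suc l)) + length (extensions x (suc k) l)
    ≤⟨ +-mono-≤ (length-extensions x k (suc l)) (length-extensions x (suc k) l) ⟩
  binom k (suc l) + binom (suc k) l                        ∎
  where
  open ≤-Reasoning
  on  = List.map (true ∷_) (extensions x k (suc l))
  off = List.map (false ∷_) (extensions x (suc k) l)

newOnes : BitString n → BitString n → ℕ
newOnes []          []          = 0
newOnes (true  ∷ x) (_ ∷ y)     = newOnes x y
newOnes (false ∷ x) (true  ∷ y) = suc (newOnes x y)
newOnes (false ∷ x) (false ∷ y) = newOnes x y

commonZeros : BitString n → BitString n → ℕ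
commonZeros []          []          = 0
commonZeros (true  ∷ x) (_ ∷ y)     = commonZeros x y
commonZeros (false ∷ x) (true  ∷ y) = commonZeros x y
commonZeros (false ∷ x) (false ∷ y) = suc (commonZeros x y)

commonZeros-comm : (x y : BitString n) → commonZeros x y ≡ commonZeros y x
commonZeros-comm []          []          = refl
commonZeros-comm (true  ∷ x) (true  ∷ y) = commonZeros-comm x y
commonZeros-comm (true  ∷ x) (false ∷ y) = commonZeros-comm x y
commonZeros-comm (false ∷ x) (true  ∷ y) = commonZeros-comm x y
commonZeros-comm (false ∷ x) (false ∷ y) = cong suc (commonZeros-comm x y)

newOnes+newOnes+commonZeros≤n : (x y : BitString n) → newOnes x y + newOnes y x + commonZeros x y ≤ n
newOnes+newOnes+commonZeros≤n []          []          = z≤n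
newOnes+newOnes+commonZeros≤n (true  ∷ x) (true  ∷ y) = m≤n⇒m≤1+n (newOnes+newOnes+commonZeros≤n x y)
newOnes+newOnes+commonZeros≤n {suc n} (true  ∷ x) (false ∷ y) =
  subst (_≤ suc n) (sym (cong (_+ commonZeros x y) (+-suc (newOnes x y) (newOnes y x))))
        (s≤s (newOnes+newOnes+commonZeros≤n x y))
newOnes+newOnes+commonZeros≤n (false ∷ x) (true  ∷ y) = s≤s (newOnes+newOnes+commonZeros≤n x y)
newOnes+newOnes+commonZeros≤n {suc n} (false ∷ x) (false ∷ y) =
  subst (_≤ suc n) (sym (+-suc _ (commonZeros x y))) (s≤s (newOnes+newOnes+commonZeros≤n x y))

⋁-∈-extensions : (x y : BitString n) → x ⋁ y ∈ extensions x (newOnes x y) (commonZeros x y)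
⋁-∈-extensions []          []          = here refl
⋁-∈-extensions (true  ∷ x) (_ ∷ y)     = ∈-map⁺ (true ∷_) (⋁-∈-extensions x y)
⋁-∈-extensions (false ∷ x) (true  ∷ y) with commonZeros x y | ⋁-∈-extensions x y
... | zero  | x⋁y∈ = ∈-map⁺ (true ∷_) x⋁y∈
... | suc _ | x⋁y∈ = ∈-++⁺ˡ (∈-map⁺ (true ∷_) x⋁y∈)
⋁-∈-extensions (false ∷ x) (false ∷ y) with newOnes x y | ⋁-∈-extensions x y
... | zero  | x⋁y∈ = ∈-map⁺ (false ∷_) x⋁y∈
... | suc _ | x⋁y∈ = ∈-++⁺ʳ _ (∈-map⁺ (false ∷_) x⋁y∈)

block : ℕ → BitString n → ℕ → ℕ → List (BitString n)
block Q x k l with binom k l ≤? Q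
... | yes _ = extensions x k l
... | no  _ = List.[]

length-block : ∀ Q (x : BitString n) k l → length (block Q x k l) ≤ Q
length-block Q x k l with binom k l ≤? Q
... | yes small = ≤-trans (length-extensions x k l) small
... | no  _     = z≤n

∈-block : ∀ Q (x : BitString n) k l {z} → binom k l ≤ Q → z ∈ extensions x k l → z ∈ block Q x k l
∈-block Q x k l small z∈ with binom k l ≤? Q
... | yes _     = z∈
... | no  large = contradiction small large

length-concatMap-≤ : (f : A → List B) → (∀ a → length (f a) ≤ d) → ∀ as → length (concatMap f as) ≤ length as * d
length-concatMap-≤ f bound List.[]       = z≤n
length-concatMap-≤ f bound (a List.∷ as) =
  ≤-trans (≤-reflexive (length-++ (f a))) (+-mono-≤ (bound a) (length-concatMap-≤ f bound as))

length-concatMap-upTo-≤ : (f : ℕ → List A) → (∀ k → length (f k) ≤ d) → ∀ n → length (concatMap f (upTo n)) ≤ n * d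
length-concatMap-upTo-≤ {d = d} f bound n =
  subst (length (concatMap f (upTo n)) ≤_) (cong (_* d) (length-upTo n)) (length-concatMap-≤ f bound (upTo n))

∈-concatMap-upTo : (f : ℕ → List A) {a : A} → k < n → a ∈ f k → a ∈ concatMap f (upTo n)
∈-concatMap-upTo f k<n a∈ = ∈-concatMap⁺ f (Any.map (λ { refl → a∈ }) (∈-upTo⁺ k<n))

table : ℕ → BitString n → List (BitString n)
table {n} Q x = concatMap (λ k → concatMap (block Q x k) (upTo (suc n))) (upTo (suc n))

length-table : ∀ Q (x : BitString n) → length (table Q x) ≤ suc n * (suc n * Q)
length-table {n} Q x =
  length-concatMap-upTo-≤ (λ k → concatMap (block Q x k) (upTo (suc n)))
    (λ k → length-concatMap-upTo-≤ (block Q x k) (length-block Q x k) (suc n)) (suc n)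

∈-table : ∀ {Q} {x z : BitString n} → k ≤ n → l ≤ n → binom k l ≤ Q → z ∈ extensions x k l → z ∈ table Q x
∈-table {n} {k} {l} {Q} {x} k≤n l≤n small z∈ =
  ∈-concatMap-upTo (λ k → concatMap (block Q x k) (upTo (suc n))) (s≤s k≤n)
    (∈-concatMap-upTo (block Q x k) (s≤s l≤n) (∈-block Q x k l small z∈))

padTo : ∀ N → A → List A → Vec A N
padTo zero    _ _            = []
padTo (suc N) d List.[]      = d ∷ padTo N d List.[]
padTo (suc N) d (a List.∷ as) = a ∷ padTo N d as

∈⇒lookup-padTo : ∀ {N} {d a : A} {as} → a ∈ as → length as ≤ N → ∃ λ j → lookup (padTo N d as) j ≡ a
∈⇒lookup-padTo (here refl) (s≤s _)  = zero , refl
∈⇒lookup-padTo (there a∈)  (s≤s le) with ∈⇒lookup-padTo a∈ le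
... | j , eq = suc j , eq

-- Powers of two

-- p ≤ 2^(e/r); a record rather than an abbreviation so that p, e and r can be inferred.
infix 4 _≤2^[_/_]

record _≤2^[_/_] (p e r : ℕ) : Set where
  constructor ≤2^-intro
  field
    ≤2^-elim : p ^ r ≤ 2 ^ e


^-distribʳ-* : ∀ p q r → (p * q) ^ r ≡ p ^ r * q ^ r
^-distribʳ-* p q zero    = refl
^-distribʳ-* p q (suc r) = begin
  p * q * (p * q) ^ r       ≡⟨ cong (p * q *_) (^-distribʳ-* p q r) ⟩
  p * q * (p ^ r * q ^ r)   ≡⟨ *-interchange p q (p ^ r) (q ^ r) ⟩
  p * p ^ r * (q * q ^ r)   ∎
  where open ≡-Reasoning

^-comm-exponents : ∀ p e r → (p ^ e) ^ r ≡ (p ^ r) ^ e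
^-comm-exponents p e r = trans (^-*-assoc p e r) (trans (cong (p ^_) (*-comm e r)) (sym (^-*-assoc p r e)))

≤2^-* : ∀ {p q} → p ≤2^[ e / r ] → q ≤2^[ f / r ] → p * q ≤2^[ e + f / r ]
≤2^-* {e} {r} {f} {p} {q} (≤2^-intro p≤) (≤2^-intro q≤) = ≤2^-intro (begin
  (p * q) ^ r    ≡⟨ ^-distribʳ-* p q r ⟩
  p ^ r * q ^ r  ≤⟨ *-mono-≤ p≤ q≤ ⟩
  2 ^ e * 2 ^ f  ≡⟨ ^-distribˡ-+-* 2 e f ⟨
  2 ^ (e + f)    ∎)
  where open ≤-Reasoning

≤-≤2^-trans : ∀ {p q} → p ≤ q → q ≤2^[ e / r ] → p ≤2^[ e / r ]
≤-≤2^-trans {r = r} p≤q (≤2^-intro q≤) = ≤2^-intro (≤-trans (^-monoˡ-≤ r p≤q) q≤)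

≤2^-≤-trans : ∀ {p} → p ≤2^[ e / r ] → e ≤ f → p ≤2^[ f / r ]
≤2^-≤-trans (≤2^-intro p≤) e≤f = ≤2^-intro (≤-trans p≤ (^-monoʳ-≤ 2 e≤f))

2^-≤2^ : ∀ d r → 2 ^ d ≤2^[ d * r / r ]
2^-≤2^ d r = ≤2^-intro (≤-reflexive (^-*-assoc 2 d r))

m<suc[m/n]*n : ∀ m n .{{_ : NonZero n}} → m < suc (m / n) * n
m<suc[m/n]*n m n = begin-strict
  m                  ≡⟨ m≡m%n+[m/n]*n m n ⟩
  m % n + m / n * n  <⟨ +-monoˡ-< (m / n * n) (m%n<n m n) ⟩
  n + m / n * n      ∎
  where open ≤-Reasoning

≤2^⇒≤ : ∀ {p} r .{{_ : NonZero r}} → p ≤2^[ e / r ] → p ≤ 2 ^ suc (e / r)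
≤2^⇒≤ {e} {p} r (≤2^-intro p≤) = ≮⇒≥ λ root<p → <⇒≱ (^-monoˡ-< r root<p) (begin
  p ^ r                   ≤⟨ p≤ ⟩
  2 ^ e                   ≤⟨ ^-monoʳ-≤ 2 (<⇒≤ (m<suc[m/n]*n e r)) ⟩
  2 ^ (suc (e / r) * r)   ≡⟨ ^-*-assoc 2 (suc (e / r)) r ⟨
  (2 ^ suc (e / r)) ^ r   ∎)
  where open ≤-Reasoning

binom-weighted : ∀ p q k l → binom k l * p ^ k * q ^ l ≤ (p + q) ^ (k + l)
binom-weighted p q zero l = begin
  1 * 1 * q ^ l  ≡⟨ +-identityʳ (q ^ l) ⟩
  q ^ l          ≤⟨ ^-monoˡ-≤ l (m≤n+m q p) ⟩
  (p + q) ^ l    ∎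
  where open ≤-Reasoning
binom-weighted p q (suc k) zero = begin
  1 * p ^ suc k * 1        ≡⟨ *-identityʳ (1 * p ^ suc k) ⟩
  1 * p ^ suc k            ≡⟨ *-identityˡ (p ^ suc k) ⟩
  p ^ suc k                ≤⟨ ^-monoˡ-≤ (suc k) (m≤m+n p q) ⟩
  (p + q) ^ suc k          ≡⟨ cong ((p + q) ^_) (+-identityʳ (suc k)) ⟨
  (p + q) ^ (suc k + 0)    ∎
  where open ≤-Reasoning
binom-weighted p q (suc k) (suc l) = begin
  (c₁ + c₂) * (p * p ^ k) * (q * q ^ l)
    ≡⟨ split c₁ c₂ p q (p ^ k) (q ^ l) ⟩
  p * (c₁ * p ^ k * (q * q ^ l)) + q * (c₂ * (p * p ^ k) * q ^ l)
    ≤⟨ +-mono-≤ (*-monoʳ-≤ p (binom-weighted p q k (suc l))) (*-monoʳ-≤ q (binom-weighted p q (suc k) l)) ⟩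
  p * (p + q) ^ (k + suc l) + q * (p + q) ^ (suc k + l)
    ≡⟨ cong (λ e → p * (p + q) ^ (k + suc l) + q * (p + q) ^ e) (+-suc k l) ⟨
  p * (p + q) ^ (k + suc l) + q * (p + q) ^ (k + suc l)
    ≡⟨ *-distribʳ-+ ((p + q) ^ (k + suc l)) p q ⟨
  (p + q) ^ (suc k + suc l) ∎
  where
  open ≤-Reasoning
  c₁ = binom k (suc l)
  c₂ = binom (suc k) l
  split : ∀ a b p q P Q → (a + b) * (p * P) * (q * Q) ≡ p * (a * P * (q * Q)) + q * (b * (p * P) * Q)
  split = solve-∀

binom-≤2^ : ∀ p q r α β .{{_ : NonZero p}} .{{_ : NonZero q}} →
            (p + q) ^ r ≤ p ^ r * 2 ^ α → (p + q) ^ r ≤ q ^ r * 2 ^ β →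
            ∀ k l → binom k l ≤2^[ α * k + β * l / r ]
binom-≤2^ p q r α β hp hq k l = ≤2^-intro (*-cancelʳ-≤ (binom k l ^ r) (2 ^ (α * k + β * l)) X {{X≢0}} (begin
  binom k l ^ r * X                          ≡⟨ unweight ⟩
  (binom k l * p ^ k * q ^ l) ^ r            ≤⟨ ^-monoˡ-≤ r (binom-weighted p q k l) ⟩
  ((p + q) ^ (k + l)) ^ r                    ≡⟨ ^-comm-exponents (p + q) (k + l) r ⟩
  ((p + q) ^ r) ^ (k + l)                    ≡⟨ ^-distribˡ-+-* ((p + q) ^ r) k l ⟩
  ((p + q) ^ r) ^ k * ((p + q) ^ r) ^ l      ≤⟨ *-mono-≤ (^-monoˡ-≤ k hp) (^-monoˡ-≤ l hq) ⟩
  (p ^ r * 2 ^ α) ^ k * (q ^ r * 2 ^ β) ^ l  ≡⟨ reweight ⟩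
  2 ^ (α * k + β * l) * X                    ∎))
  where
  open ≤-Reasoning
  X = (p ^ r) ^ k * (q ^ r) ^ l
  X≢0 : NonZero X
  X≢0 = m*n≢0 _ _ {{m^n≢0 _ k {{m^n≢0 p r}}}} {{m^n≢0 _ l {{m^n≢0 q r}}}}
  unweight : binom k l ^ r * X ≡ (binom k l * p ^ k * q ^ l) ^ r
  unweight = sym (begin-equality
    (binom k l * p ^ k * q ^ l) ^ r              ≡⟨ ^-distribʳ-* (binom k l * p ^ k) (q ^ l) r ⟩
    (binom k l * p ^ k) ^ r * (q ^ l) ^ r        ≡⟨ cong (_* (q ^ l) ^ r) (^-distribʳ-* (binom k l) (p ^ k) r) ⟩
    binom k l ^ r * (p ^ k) ^ r * (q ^ l) ^ r    ≡⟨ cong₂ (λ u v → binom k l ^ r * u * v)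
                                                          (^-comm-exponents p k r) (^-comm-exponents q l r) ⟩
    binom k l ^ r * (p ^ r) ^ k * (q ^ r) ^ l    ≡⟨ *-assoc (binom k l ^ r) _ _ ⟩
    binom k l ^ r * X                            ∎)
  reweight : (p ^ r * 2 ^ α) ^ k * (q ^ r * 2 ^ β) ^ l ≡ 2 ^ (α * k + β * l) * X
  reweight = begin-equality
    (p ^ r * 2 ^ α) ^ k * (q ^ r * 2 ^ β) ^ l
      ≡⟨ cong₂ _*_ (^-distribʳ-* (p ^ r) (2 ^ α) k) (^-distribʳ-* (q ^ r) (2 ^ β) l) ⟩
    (p ^ r) ^ k * (2 ^ α) ^ k * ((q ^ r) ^ l * (2 ^ β) ^ l)
      ≡⟨ *-interchange ((p ^ r) ^ k) ((2 ^ α) ^ k) ((q ^ r) ^ l) ((2 ^ β) ^ l) ⟩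
    X * ((2 ^ α) ^ k * (2 ^ β) ^ l)
      ≡⟨ cong₂ (λ u v → X * (u * v)) (^-*-assoc 2 α k) (^-*-assoc 2 β l) ⟩
    X * (2 ^ (α * k) * 2 ^ (β * l))
      ≡⟨ cong (X *_) (^-distribˡ-+-* 2 (α * k) (β * l)) ⟨
    X * 2 ^ (α * k + β * l)
      ≡⟨ *-comm X _ ⟩
    2 ^ (α * k + β * l) * X ∎

-- 13^1000 ≤ 5^1000 · 2^1402 and 13^1000 ≤ 8^1000 · 2^701, i.e. log₂(13/5) ≤ 1.402 and log₂(13/8) ≤ 0.701.
binom-≤2^701 : ∀ k l → binom k l ≤2^[ 701 * (2 * k + l) / 1000 ]
binom-≤2^701 k l = subst (λ e → binom k l ≤2^[ e / 1000 ]) (exponent k l)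
  (binom-≤2^ 5 8 1000 1402 701 (≤ᵇ⇒≤ _ _ _) (≤ᵇ⇒≤ _ _ _) k l)
  where
  exponent : ∀ k l → 1402 * k + 701 * l ≡ 701 * (2 * k + l)
  exponent = solve-∀

n<2^n : ∀ n → n < 2 ^ n
n<2^n zero    = s≤s z≤n
n<2^n (suc n) = subst (suc (suc n) ≤_) (sym (cong (2 ^ n +_) (+-identityʳ (2 ^ n))))
                      (+-mono-≤ (m^n>0 2 n) (n<2^n n))

suc≤*2^/ : ∀ m d .{{_ : NonZero d}} → suc m ≤ d * 2 ^ (m / d)
suc≤*2^/ m d = begin
  suc m              ≤⟨ m<suc[m/n]*n m d ⟩
  suc (m / d) * d    ≡⟨ *-comm (suc (m / d)) d ⟩
  d * suc (m / d)    ≤⟨ *-monoʳ-≤ d (n<2^n (m / d)) ⟩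
  d * 2 ^ (m / d)    ∎
  where open ≤-Reasoning

^-split : ∀ b e r f → b ^ (f + e * r) ≡ (b ^ e) ^ r * b ^ f
^-split b e r f = begin
  b ^ (f + e * r)       ≡⟨ ^-distribˡ-+-* b f (e * r) ⟩
  b ^ f * b ^ (e * r)   ≡⟨ *-comm (b ^ f) (b ^ (e * r)) ⟩
  b ^ (e * r) * b ^ f   ≡⟨ cong (_* b ^ f) (^-*-assoc b e r) ⟨
  (b ^ e) ^ r * b ^ f   ∎
  where open ≡-Reasoning

≤-^-split : ∀ {s} e r f → s ≤ 2 ^ (f + e * r) → s ≤ (2 ^ e) ^ r * 2 ^ f
≤-^-split {s} e r f = subst (s ≤_) (^-split 2 e r f)

threshold : ℕ → ℕ
threshold n = 2 ^ suc (701 * n / 1000)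

binom-≤-threshold : ∀ k l → 2 * k + l ≤ n → binom k l ≤ threshold n
binom-≤-threshold k l h =
  ≤2^⇒≤ 1000 (≤2^-≤-trans (binom-≤2^701 k l) (*-monoʳ-≤ 701 h))

2*m≤m+n : ∀ {m n} → m ≤ n → 2 * m ≤ m + n
2*m≤m+n {m} m≤n = +-monoʳ-≤ m (subst (_≤ _) (sym (+-identityʳ m)) m≤n)

smaller-side : ∀ k k′ l → k + k′ + l ≤ n → 2 * k + l ≤ n ⊎ 2 * k′ + l ≤ n
smaller-side k k′ l h with ≤-total k k′
... | inj₁ k≤k′ = inj₁ (≤-trans (+-monoˡ-≤ l (2*m≤m+n k≤k′)) h)
... | inj₂ k′≤k = inj₂ (≤-trans (+-monoˡ-≤ l (subst (2 * k′ ≤_) (+-comm k′ k) (2*m≤m+n k′≤k))) h)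

⋁-∈-table : (x y : BitString n) → 2 * newOnes x y + commonZeros x y ≤ n → x ⋁ y ∈ table (threshold n) x
⋁-∈-table x y h = ∈-table k≤n l≤n (binom-≤-threshold (newOnes x y) (commonZeros x y) h) (⋁-∈-extensions x y)
  where
  k≤n = ≤-trans (≤-trans (m≤m+n (newOnes x y) _) (m≤m+n _ (commonZeros x y))) h
  l≤n = ≤-trans (m≤n+m (commonZeros x y) _) h

-- The protocol

module Protocol (n T : ℕ) where

  L : ℕ
  L = n + (suc T + suc T * n)

  message : (BitString n → Bool) → BitString n → Vec (BitString n) (suc T) → BitString L
  message g x zs = x ++ (map g zs ++ concat zs)

  inputBit : Fin n → Fin L
  inputBit i = i ↑ˡ _

  valueBit : Fin (suc T) → Fin L
  valueBit j = n ↑ʳ (j ↑ˡ _)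

  entryBit : Fin (suc T) → Fin n → Fin L
  entryBit j i = n ↑ʳ (suc T ↑ʳ combine j i)

  module _ (g : BitString n → Bool) (x : BitString n) (zs : Vec (BitString n) (suc T)) where

    lookup-inputBit : ∀ i → lookup (message g x zs) (inputBit i) ≡ lookup x i
    lookup-inputBit = lookup-++ˡ x _

    lookup-valueBit : ∀ j → lookup (message g x zs) (valueBit j) ≡ g (lookup zs j)
    lookup-valueBit j = trans (lookup-++ʳ x _ _) (trans (lookup-++ˡ (map g zs) _ j) (lookup-map j g zs))

    lookup-entryBit : ∀ j i → lookup (message g x zs) (entryBit j i) ≡ lookup (lookup zs j) i
    lookup-entryBit j i = trans (lookup-++ʳ x _ _) (trans (lookup-++ʳ (map g zs) _ _) (lookup-concat zs j i))

  orBit : Fin n → Formula (L + L)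
  orBit i = gate _∨_ (input (inputBit i ↑ˡ L)) (input (L ↑ʳ inputBit i))

  entryTest : (Fin L → Fin (L + L)) → Fin (suc T) → Formula (L + L)
  entryTest side j =
    foldF _∧_ (input (side (valueBit j))) λ i → gate _==_ (input (side (entryBit j i))) (orBit i)

  carol : Formula (L + L)
  carol = gate _∨_ (⋁F (entryTest (_↑ˡ L))) (⋁F (entryTest (L ↑ʳ_)))

  ⟦carol⟧ : ∀ g (x y : BitString n) zs zs′ →
            ⟦ carol ⟧ (lookup (message g x zs ++ message g y zs′)) ≡
            anyAccepts g zs (x ⋁ y) ∨ anyAccepts g zs′ (x ⋁ y)
  ⟦carol⟧ g x y zs zs′ =
    cong₂ _∨_ (⟦⋁F⟧ (entryTest (_↑ˡ L)) (⟦entryTest⟧ (_↑ˡ L) x zs (lookup-++ˡ mx my)))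
              (⟦⋁F⟧ (entryTest (L ↑ʳ_)) (⟦entryTest⟧ (L ↑ʳ_) y zs′ (lookup-++ʳ mx my)))
    where
    mx = message g x zs
    my = message g y zs′
    ρ = lookup (mx ++ my)
    ⟦orBit⟧ : ∀ i → ⟦ orBit i ⟧ ρ ≡ lookup (x ⋁ y) i
    ⟦orBit⟧ i = trans (cong₂ _∨_ (trans (lookup-++ˡ mx my _) (lookup-inputBit g x zs i))
                                 (trans (lookup-++ʳ mx my _) (lookup-inputBit g y zs′ i)))
                      (sym (lookup-zipWith _∨_ i x y))
    ⟦entryTest⟧ : ∀ side u us → (∀ b → ρ (side b) ≡ lookup (message g u us) b) →
                  ∀ j → ⟦ entryTest side j ⟧ ρ ≡ accepts (g (lookup us j)) (lookup us j) (x ⋁ y)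
    ⟦entryTest⟧ side u us reads j =
      ⟦foldF⟧ (trans (reads _) (lookup-valueBit g u us j))
              λ i → cong₂ _==_ (trans (reads _) (lookup-entryBit g u us j i)) (⟦orBit⟧ i)

  size-carol : size carol ≡ suc (T * suc (n * 3 + 0) + (n * 3 + 0) + (T * suc (n * 3 + 0) + (n * 3 + 0)))
  size-carol = cong suc (cong₂ _+_ (size-⋁F (entryTest (_↑ˡ L)) (size-entryTest (_↑ˡ L)))
                                  (size-⋁F (entryTest (L ↑ʳ_)) (size-entryTest (L ↑ʳ_))))
    where
    size-entryTest : ∀ side j → size (entryTest side j) ≡ n * 3 + 0
    size-entryTest side j = size-foldF (input (side (valueBit j))) _ λ i → refl

  size-carol-≤ : 1 ≤ T → size carol ≤ 16 * (suc n * T)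
  size-carol-≤ (s≤s {n = t} _) rewrite size-carol = count-≤ n t
    where
    count-≤ : ∀ n t → let S = suc t * suc (n * 3 + 0) + (n * 3 + 0) in suc (S + S) ≤ 16 * (suc n * suc t)
    count-≤ n t = ≤-trans (m≤m+n _ (10 * n * t + 4 * n + 14 * t + 13)) (≤-reflexive (slack n t))
      where
      slack : ∀ n t → let S = suc t * suc (n * 3 + 0) + (n * 3 + 0) in
              suc (S + S) + (10 * n * t + 4 * n + 14 * t + 13) ≡ 16 * (suc n * suc t)
      slack = solve-∀

exponent-≤ : ∀ n → 4 * 1000 + ((7 + n / 128) * 1000 + ((7 + n / 128) * 1000 +
                     ((7 + n / 128) * 1000 + suc (701 * n / 1000) * 1000))) ≤ 729 * n + 26 * 1000
exponent-≤ n = begin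
  4 * 1000 + ((7 + n / 128) * 1000 + ((7 + n / 128) * 1000 +
    ((7 + n / 128) * 1000 + suc (701 * n / 1000) * 1000)))
    ≡⟨ regroup (n / 128) (701 * n / 1000) 1000 ⟩
  3 * (n / 128 * 1000) + 701 * n / 1000 * 1000 + 26 * 1000
    ≤⟨ +-monoˡ-≤ (26 * 1000) (+-mono-≤ (*-monoʳ-≤ 3 dyadic) (m/n*n≤m (701 * n) 1000)) ⟩
  3 * (8 * n) + 701 * n + 26 * 1000
    ≡⟨ cong (λ e → e + 701 * n + 26 * 1000) (*-assoc 3 8 n) ⟨
  24 * n + 701 * n + 26 * 1000
    ≡⟨ cong (_+ 26 * 1000) (*-distribʳ-+ n 24 701) ⟨
  725 * n + 26 * 1000
    ≤⟨ +-monoˡ-≤ (26 * 1000) (*-monoˡ-≤ n (≤ᵇ⇒≤ 725 729 _)) ⟩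
  729 * n + 26 * 1000 ∎
  where
  open ≤-Reasoning
  regroup : ∀ q p r → 4 * r + ((7 + q) * r + ((7 + q) * r + ((7 + q) * r + suc p * r)))
                      ≡ 3 * (q * r) + p * r + 26 * r
  regroup = solve-∀
  dyadic : n / 128 * 1000 ≤ 8 * n
  dyadic = begin
    n / 128 * 1000      ≤⟨ *-monoʳ-≤ (n / 128) (≤ᵇ⇒≤ 1000 1024 _) ⟩
    n / 128 * 1024      ≡⟨ *-assoc (n / 128) 128 8 ⟨
    n / 128 * 128 * 8   ≤⟨ *-monoˡ-≤ 8 (m/n*n≤m n 128) ⟩
    n * 8               ≡⟨ *-comm n 8 ⟩
    8 * n               ∎

module _ (n : ℕ) (g : BitString n → Bool) where

  T : ℕ
  T = suc n * (suc n * threshold n)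

  open Protocol n T

  -- Padding with x is harmless: every entry, padded or not, is stored with its value under g.
  entries : BitString n → Vec (BitString n) (suc T)
  entries x = padTo (suc T) x (table (threshold n) x)

  alice : BitString n → BitString L
  alice x = message g x (entries x)

  accepted : ∀ x y → 2 * newOnes x y + commonZeros x y ≤ n → g (x ⋁ y) ≤ᴮ anyAccepts g (entries x) (x ⋁ y)
  accepted x y h =
    let j , listed = ∈⇒lookup-padTo (⋁-∈-table x y h) (m≤n⇒m≤1+n (length-table (threshold n) x))
    in ≤-anyAccepts g (entries x) j listed

  accepted-by-either : ∀ x y →
    g (x ⋁ y) ≤ᴮ anyAccepts g (entries x) (x ⋁ y) ∨ anyAccepts g (entries y) (x ⋁ y)
  accepted-by-either x y =
    by-side (smaller-side (newOnes x y) (newOnes y x) (commonZeros x y) (newOnes+newOnes+commonZeros≤n x y))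
    where
    by-side : 2 * newOnes x y + commonZeros x y ≤ n ⊎ 2 * newOnes y x + commonZeros x y ≤ n →
              g (x ⋁ y) ≤ᴮ anyAccepts g (entries x) (x ⋁ y) ∨ anyAccepts g (entries y) (x ⋁ y)
    by-side (inj₁ h) = ≤ᴮ-trans (accepted x y h) ≤-∨ˡ
    by-side (inj₂ h) = ≤ᴮ-trans
      (subst (λ w → g w ≤ᴮ anyAccepts g (entries y) w) (zipWith-comm ∨-comm y x)
             (accepted y x (subst (λ c → 2 * newOnes y x + c ≤ n) (commonZeros-comm x y) h)))
      ≤-∨ʳ

  carol-correct : ∀ x y → ⟦ carol ⟧ (lookup (alice x ++ alice y)) ≡ g (x ⋁ y)
  carol-correct x y = trans (⟦carol⟧ g x y (entries x) (entries y))
    (≤ᴮ-antisym (∨-lub (anyAccepts-≤ g (entries x) (x ⋁ y)) (anyAccepts-≤ g (entries y) (x ⋁ y)))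
                (accepted-by-either x y))

  protocol : BSM n (λ x y → g (x ⋁ y)) (size carol)
  protocol = record
    { lenA = L ; lenB = L ; alice = alice ; bob = alice
    ; carol = proj₁ circuit
    ; correct = λ x y → trans (proj₂ circuit (alice x ++ alice y)) (carol-correct x y)
    }
    where circuit = formula⇒circuit carol

  carol-≤2^ : ∀ {r e₁ e₂} → suc n ≤2^[ e₁ / r ] → threshold n ≤2^[ e₂ / r ] →
              size carol ≤2^[ 4 * r + (e₁ + (e₁ + (e₁ + e₂))) / r ]
  carol-≤2^ {r} n≤ threshold≤ =
    ≤-≤2^-trans (size-carol-≤ T≥1) (≤2^-* (2^-≤2^ 4 r) (≤2^-* n≤ (≤2^-* n≤ (≤2^-* n≤ threshold≤))))
    where
    T≥1 : 1 ≤ T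
    T≥1 = ≤-trans (m^n>0 2 (suc (701 * n / 1000))) (≤-trans (m≤n*m _ (suc n)) (m≤n*m _ (suc n)))

  size-≤2^ : size carol ≤2^[ 729 * n + 26 * 1000 / 1000 ]
  size-≤2^ = ≤2^-≤-trans (carol-≤2^ suc-n (2^-≤2^ (suc (701 * n / 1000)) 1000)) (exponent-≤ n)
    where
    suc-n : suc n ≤2^[ (7 + n / 128) * 1000 / 1000 ]
    suc-n = ≤-≤2^-trans (subst (suc n ≤_) (sym (^-distribˡ-+-* 2 7 (n / 128))) (suc≤*2^/ n 128))
                        (2^-≤2^ (7 + n / 128) 1000)

  protocol-size : size carol ^ 1000 ≤ (2 ^ 26) ^ 1000 * 2 ^ (729 * n)
  protocol-size = unwrap size-≤2^
    where
    unwrap : size carol ≤2^[ 729 * n + 26 * 1000 / 1000 ] → size carol ^ 1000 ≤ (2 ^ 26) ^ 1000 * 2 ^ (729 * n)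
    unwrap (≤2^-intro bound) = ≤-^-split 26 1000 (729 * n) bound

theoremB25 : Σ ℕ λ c → Σ ℕ λ N₀ → (n : ℕ) → N₀ ≤ n →
    (g : BitString n → Bool) →
    Σ ℕ λ s → BSM n (λ x y → g (x ⋁ y)) s ×
      s ^ 1000 ≤ c ^ 1000 * 2 ^ (729 * n)
theoremB25 = 2 ^ 26 , 0 , λ n _ g → _ , protocol n g , protocol-size n g
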